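{- For any $\delta$ with $0<\delta<\gamma$, there exists an integer $K\ge1$ such that: for any pre-sorted online $B$-bounded space algorithm $ALG$ for the classic bin packing problem and any positive integer $m$, there exists a sorted item sequence $I$ with $OPT(I)=m$ and $ALG(I)>(\gamma-\delta)\cdot OPT(I)-B(K-1)$.
   Context: Define $\pi_1=2$ and $\pi_{i+1}=\pi_i(\pi_i-1)+1$ for $i\ge1$, and $\gamma=\sum_{i=1}^\infty\frac{1}{\pi_i-1}\approx1.69$. Classic bin packing: an input is an item sequence $I=(a_1,\dots,a_n)\in(0,1]^n$; it is sorted if $a_1\ge\cdots\ge a_n$. An assignment is a map $f:\{1,\dots,n\}\to\mathbb{N}$ with $\sum_{i:f(i)=j}a_i\le1$ for every bin $j$; its cost is the number of non-empty bins. $OPT(I)$ is the minimum cost and $ALG(I)$ the cost of $ALG$'s assignment. A pre-sorted online algorithm first sorts the input in non-increasing order and then repeatedly packs the head (largest remaining) item into some bin, irrevocably and without seeing the other remaining items. A bin is open if it has received an item and may still receive items; closed bins never receive items again. A $B$-bounded space algorithm has at most $B$ open bins at any time.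
   Formalization: The parameter δ ranges over the rationals, and item sizes are taken in the rationals, both for the inputs on which ALG acts and for the sorted item sequence I. -}

module Defs where

open import Data.Nat as ℕ using (ℕ; zero; suc; _∸_)
open import Data.Integer using (+_)
open import Data.Rational using (ℚ; 0ℚ; 1ℚ; _+_; _-_; _*_; _/_; _<_; _≤_)
open import Data.List using (List; []; _∷_; _++_; [_]; length; map; filter; deduplicate; zip; foldr; take; concatMap; lookup)
open import Data.List.Membership.DecPropositional ℕ._≟_ using (_∈?_; _∈_; _∉_)
open import Data.List.Relation.Unary.All using (All)
open import Data.List.Relation.Unary.AllPairs using (AllPairs)
open import Data.Product using (Σ; ∃; ∃-syntax; _×_; _,_; proj₁; proj₂)
open import Data.Fin using (Fin; toℕ)
open import Relation.Nullary using (¬_; ¬?)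
open import Relation.Binary.PropositionalEquality using (_≡_)

-- Sylvester's sequence and the constant γ
-- π i here is π_{i+1} of the paper (π 0 = π_1 = 2).

π : ℕ → ℕ
π zero    = 2
π (suc i) = π i ℕ.* (π i ∸ 1) ℕ.+ 1

-- 1 / (π i - 1); since π i ≥ 2 we have suc (π i ∸ 2) = π i - 1.
invπ-1 : ℕ → ℚ
invπ-1 i = + 1 / suc (π i ∸ 2)

-- partial sums S N = Σ_{i=1}^{N} 1/(π_i - 1); γ = lim S N (S is increasing)
S : ℕ → ℚ
S zero    = 0ℚ
S (suc N) = S N + invπ-1 N

-- For an increasing rational sequence f with (real) limit L = sup f:
--   q < L   iff  some f N exceeds q
--   L < q   iff  for some rational ε > 0 all f N + ε ≤ q
LtLim : ℚ → (ℕ → ℚ) → Set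
LtLim q f = ∃[ N ] (q < f N)

LimLt : (ℕ → ℚ) → ℚ → Set
LimLt f q = ∃[ ε ] ((0ℚ < ε) × (∀ N → f N + ε ≤ q))

fromℕ : ℕ → ℚ
fromℕ n = + n / 1

ValidItems : List ℚ → Set
ValidItems I = All (λ a → (0ℚ < a) × (a ≤ 1ℚ)) I

Sorted : List ℚ → Set
Sorted I = AllPairs (λ a b → b ≤ a) I

sumℚ : List ℚ → ℚ
sumℚ = foldr _+_ 0ℚ

-- an assignment is given as the list of bin indices (f(1), …, f(n))
load : List ℚ → List ℕ → ℕ → ℚ
load I f j = sumℚ (map proj₁ (filter (λ p → proj₂ p ℕ.≟ j) (zip I f)))

IsAssignment : List ℚ → List ℕ → Set
IsAssignment I f = (length f ≡ length I) × (∀ j → load I f j ≤ 1ℚ)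

-- number of non-empty bins = number of distinct bin indices used
cost : List ℕ → ℕ
cost f = length (deduplicate ℕ._≟_ f)

IsOPT : List ℚ → ℕ → Set
IsOPT I m = (∃[ f ] (IsAssignment I f × cost f ≡ m))
          × (∀ f → IsAssignment I f → m ℕ.≤ cost f)

-- When the head item a arrives, having already seen items `past` (in
-- order), the algorithm first closes the bins in `close`, then packs a
-- into bin `bin` (an open bin or a new one). It sees nothing else.

record Decision : Set where
  constructor decision
  field
    close : List ℕ
    bin   : ℕ
open Decision public

Alg : Set
Alg = List ℚ → ℚ → Decision

decisions : Alg → List ℚ → List Decision
decisions alg = go []
  where
  go : List ℚ → List ℚ → List Decision
  go past []       = []
  go past (a ∷ as) = alg past a ∷ go (past ++ [ a ]) as

assign : Alg → List ℚ → List ℕ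
assign alg I = map bin (decisions alg I)

ALG : Alg → List ℚ → ℕ
ALG alg I = cost (assign alg I)

-- bins closed up to and including step t (0-based), and bins open right
-- after item t has been packed
closedUpTo : List Decision → ℕ → List ℕ
closedUpTo ds t = concatMap close (take (suc t) ds)

openAfter : List Decision → ℕ → List ℕ
openAfter ds t =
  deduplicate ℕ._≟_
    (filter (λ j → ¬? (j ∈? closedUpTo ds t)) (map bin (take (suc t) ds)))

BoundedSpaceAlg : ℕ → Alg → Set
BoundedSpaceAlg B alg =
  ∀ I → ValidItems I → Sorted I →
    let ds = decisions alg I in
      (∀ (t : Fin (length ds)) →
           (bin (lookup ds t) ∉ closedUpTo ds (toℕ t))
         × (length (openAfter ds (toℕ t)) ℕ.≤ B))
    × (∀ j → load I (assign alg I) j ≤ 1ℚ)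

module Submission where

-- Fix k levels and let D = k (π k - 1), where π i is π_{i+1} of the paper. Level i < k consists
-- of m items of size 1/π i + 1/D. By Sylvester's identity Σ_{i<k} 1/π i = 1 - 1/(π k - 1), one
-- item of each level fills a bin exactly, so OPT = m; but a bin holds at most π i - 1 items of
-- level i. The input is sorted, so an online algorithm receives the levels one after another:
-- level i occupies at least m/(π i - 1) bins, and only the at most B bins open at a level
-- boundary can be shared with later levels. Hence ALG ≥ m S k - k B, and as S N ≤ S k + 2/(π k - 1)
-- for every N, choosing k with 2/(π k - 1) < δ gives the bound with K = k + 1.

module Fractions where

  open import Defs using (fromℕ)
  open import Data.Nat as ℕ using (suc)
  import Data.Nat.Properties as ℕ
  open import Data.Integer as ℤ using (+_)
  import Data.Integer.Properties as ℤ
  open import Data.Integer.Solver using (module +-*-Solver)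
  open import Data.Rational as ℚ using (_/_; toℚᵘ)
  import Data.Rational.Properties as ℚ
  open import Data.Rational.Unnormalised as ℚᵘ using (mkℚᵘ; *≡*; *≤*; *<*)
  import Data.Rational.Unnormalised.Properties as ℚᵘ
  open import Relation.Binary.PropositionalEquality

  private
    toℚᵘ-/ : ∀ a d → toℚᵘ (+ a / suc d) ℚᵘ.≃ mkℚᵘ (+ a) d
    toℚᵘ-/ a d = ℚ.toℚᵘ-fromℚᵘ (mkℚᵘ (+ a) d)

  frac-+ : ∀ a b d → + a / suc d ℚ.+ + b / suc d ≡ + (a ℕ.+ b) / suc d
  frac-+ a b d = ℚ.toℚᵘ-injective (begin
    toℚᵘ (+ a / suc d ℚ.+ + b / suc d)          ≈⟨ ℚ.toℚᵘ-homo-+ (+ a / suc d) (+ b / suc d) ⟩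
    toℚᵘ (+ a / suc d) ℚᵘ.+ toℚᵘ (+ b / suc d)  ≈⟨ ℚᵘ.+-cong (toℚᵘ-/ a d) (toℚᵘ-/ b d) ⟩
    mkℚᵘ (+ a) d ℚᵘ.+ mkℚᵘ (+ b) d              ≈⟨ *≡* cross ⟩
    mkℚᵘ (+ (a ℕ.+ b)) d                        ≈⟨ toℚᵘ-/ (a ℕ.+ b) d ⟨
    toℚᵘ (+ (a ℕ.+ b) / suc d)                  ∎)
    where
    open ℚᵘ.≃-Reasoning
    open +-*-Solver
    cross : (+ a ℤ.* + suc d ℤ.+ + b ℤ.* + suc d) ℤ.* + suc d ≡ + (a ℕ.+ b) ℤ.* + (suc d ℕ.* suc d)
    cross = trans
      (solve 3 (λ x y z → (x :* z :+ y :* z) :* z := (x :+ y) :* (z :* z)) refl (+ a) (+ b) (+ suc d))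
      (sym (cong₂ ℤ._*_ (ℤ.pos-+ a b) (ℤ.pos-* (suc d) (suc d))))

  frac-* : ∀ a b c d → (+ a / suc b) ℚ.* (+ c / suc d) ≡ + (a ℕ.* c) / (suc b ℕ.* suc d)
  frac-* a b c d = ℚ.toℚᵘ-injective (begin
    toℚᵘ ((+ a / suc b) ℚ.* (+ c / suc d))      ≈⟨ ℚ.toℚᵘ-homo-* (+ a / suc b) (+ c / suc d) ⟩
    toℚᵘ (+ a / suc b) ℚᵘ.* toℚᵘ (+ c / suc d)  ≈⟨ ℚᵘ.*-cong (toℚᵘ-/ a b) (toℚᵘ-/ c d) ⟩
    mkℚᵘ (+ a ℤ.* + c) (d ℕ.+ b ℕ.* suc d)
      ≈⟨ *≡* (cong (ℤ._* + (suc b ℕ.* suc d)) (sym (ℤ.pos-* a c))) ⟩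
    mkℚᵘ (+ (a ℕ.* c)) (d ℕ.+ b ℕ.* suc d)      ≈⟨ toℚᵘ-/ (a ℕ.* c) _ ⟨
    toℚᵘ (+ (a ℕ.* c) / (suc b ℕ.* suc d))      ∎)
    where open ℚᵘ.≃-Reasoning

  frac-mono-≤ : ∀ a b c d → a ℕ.* suc d ℕ.≤ c ℕ.* suc b → + a / suc b ℚ.≤ + c / suc d
  frac-mono-≤ a b c d ad≤cb = ℚ.toℚᵘ-cancel-≤
    (ℚᵘ.≤-respˡ-≃ (ℚᵘ.≃-sym (toℚᵘ-/ a b)) (ℚᵘ.≤-respʳ-≃ (ℚᵘ.≃-sym (toℚᵘ-/ c d))
      (*≤* (subst₂ ℤ._≤_ (ℤ.pos-* a (suc d)) (ℤ.pos-* c (suc b)) (ℤ.+≤+ ad≤cb)))))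

  frac-cancel-≤ : ∀ a b c d → + a / suc b ℚ.≤ + c / suc d → a ℕ.* suc d ℕ.≤ c ℕ.* suc b
  frac-cancel-≤ a b c d a/b≤c/d
    with *≤* ad≤cb ← ℚᵘ.≤-respˡ-≃ (toℚᵘ-/ a b)
                        (ℚᵘ.≤-respʳ-≃ (toℚᵘ-/ c d) (ℚ.toℚᵘ-mono-≤ a/b≤c/d))
    = ℤ.drop‿+≤+ (subst₂ ℤ._≤_ (sym (ℤ.pos-* a (suc d))) (sym (ℤ.pos-* c (suc b))) ad≤cb)

  frac-mono-< : ∀ a b c d → a ℕ.* suc d ℕ.< c ℕ.* suc b → + a / suc b ℚ.< + c / suc d
  frac-mono-< a b c d ad<cb = ℚ.toℚᵘ-cancel-<
    (ℚᵘ.<-respˡ-≃ (ℚᵘ.≃-sym (toℚᵘ-/ a b)) (ℚᵘ.<-respʳ-≃ (ℚᵘ.≃-sym (toℚᵘ-/ c d))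
      (*<* (subst₂ ℤ._<_ (ℤ.pos-* a (suc d)) (ℤ.pos-* c (suc b)) (ℤ.+<+ ad<cb)))))

  fromℕ-+ : ∀ a b → fromℕ (a ℕ.+ b) ≡ fromℕ a ℚ.+ fromℕ b
  fromℕ-+ a b = sym (frac-+ a b 0)

  fromℕ-mono-≤ : ∀ {a b} → a ℕ.≤ b → fromℕ a ℚ.≤ fromℕ b
  fromℕ-mono-≤ {a} {b} a≤b = frac-mono-≤ a 0 b 0 (ℕ.*-monoˡ-≤ 1 a≤b)

  m≤n*x⇒m*1/n≤x : ∀ m d x → m ℕ.≤ suc d ℕ.* x → fromℕ m ℚ.* (+ 1 / suc d) ℚ.≤ fromℕ x
  m≤n*x⇒m*1/n≤x m d x m≤nx = subst (ℚ._≤ fromℕ x) (sym (frac-* m 0 1 d))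
    (frac-mono-≤ (m ℕ.* 1) (d ℕ.+ 0) x 0 (subst₂ ℕ._≤_ m≡m*1*1 nx≡x*n m≤nx))
    where
    m≡m*1*1 : m ≡ m ℕ.* 1 ℕ.* 1
    m≡m*1*1 = sym (trans (ℕ.*-identityʳ (m ℕ.* 1)) (ℕ.*-identityʳ m))
    nx≡x*n : suc d ℕ.* x ≡ x ℕ.* suc (d ℕ.+ 0)
    nx≡x*n = trans (ℕ.*-comm (suc d) x) (cong (λ n → x ℕ.* suc n) (sym (ℕ.+-identityʳ d)))


module Distinct where

  open import Defs using (cost)
  open import Data.Nat using (ℕ; suc; _+_; _*_; _≤_; z≤n; s≤s; _≟_)
  open import Data.Nat.Properties
    using (≤-trans; +-suc; +-assoc; +-comm; +-mono-≤; *-suc; module ≤-Reasoning)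
  open import Data.Bool using (true; false)
  open import Data.List using (List; []; _∷_; _++_; length; filter; deduplicate)
  open import Data.List.Properties using (length-++; filter-notAll)
  open import Data.List.Membership.DecPropositional _≟_ using (_∈_; _∈?_)
  open import Data.List.Membership.Propositional.Properties
    using (∈-filter⁺; ∈-filter⁻; ∈-deduplicate⁺; ∈-deduplicate⁻)
  open import Data.List.Relation.Binary.Subset.Propositional using (_⊆_)
  import Data.List.Relation.Binary.Subset.Propositional.Properties as Subset
  import Data.List.Relation.Binary.Sublist.Propositional.Properties as Sublist
  import Data.List.Relation.Unary.All as All
  open import Data.List.Relation.Unary.AllPairs using ([]; _∷_)
  open import Data.List.Relation.Unary.Any as Any using (here; there)
  open import Data.List.Relation.Unary.Unique.Propositional using (Unique)
  import Data.List.Relation.Unary.Unique.Propositional.Properties as Unique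
  open import Data.List.Relation.Unary.Unique.DecPropositional.Properties _≟_ using (deduplicate-!)
  open import Data.Product using (_,_; proj₁; proj₂)
  open import Function using (_∘_)
  open import Relation.Nullary using (¬?; does; contradiction)
  open import Relation.Unary using (Pred; Decidable)
  open import Relation.Binary.PropositionalEquality

  multiplicity : ℕ → List ℕ → ℕ
  multiplicity j xs = length (filter (_≟ j) xs)

  length-filter-∁ : ∀ {a p} {A : Set a} {P : Pred A p} (P? : Decidable P) xs →
    length (filter P? xs) + length (filter (¬? ∘ P?) xs) ≡ length xs
  length-filter-∁ P? [] = refl
  length-filter-∁ P? (x ∷ xs) with ih ← length-filter-∁ P? xs | does (P? x)
  ... | true  = cong suc ih
  ... | false = trans (+-suc _ _) (cong suc ih)

  Unique-⊆⇒length≤ : ∀ {xs ys} → Unique xs → xs ⊆ ys → length xs ≤ length ys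
  Unique-⊆⇒length≤ [] _ = z≤n
  Unique-⊆⇒length≤ {x ∷ xs} {ys} (x∉xs ∷ xs!) x∷xs⊆ys =
    ≤-trans (s≤s (Unique-⊆⇒length≤ xs! xs⊆ys-x)) (filter-notAll (¬? ∘ (_≟ x)) ys x∈ys)
    where
    xs⊆ys-x : xs ⊆ filter (¬? ∘ (_≟ x)) ys
    xs⊆ys-x z∈xs = ∈-filter⁺ (¬? ∘ (_≟ x)) (x∷xs⊆ys (there z∈xs)) (All.lookup x∉xs z∈xs ∘ sym)
    x∈ys = Any.map (λ x≡y y≢x → y≢x (sym x≡y)) (x∷xs⊆ys (here refl))

  Unique-⊆⇒length≤cost : ∀ {xs ys} → Unique xs → xs ⊆ ys → length xs ≤ cost ys
  Unique-⊆⇒length≤cost xs! xs⊆ys = Unique-⊆⇒length≤ xs! (∈-deduplicate⁺ _≟_ ∘ xs⊆ys)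

  cost-mono : ∀ {xs ys} → xs ⊆ ys → cost xs ≤ cost ys
  cost-mono {xs} xs⊆ys = Unique-⊆⇒length≤cost (deduplicate-! xs) (xs⊆ys ∘ ∈-deduplicate⁻ _≟_ xs)

  ⊆⇒cost≤length : ∀ {xs ys} → xs ⊆ ys → cost xs ≤ length ys
  ⊆⇒cost≤length {xs} xs⊆ys = Unique-⊆⇒length≤ (deduplicate-! xs) (xs⊆ys ∘ ∈-deduplicate⁻ _≟_ xs)

  Unique⇒multiplicity≤1 : ∀ {xs} j → Unique xs → multiplicity j xs ≤ 1
  Unique⇒multiplicity≤1 {xs} j xs! = Unique-⊆⇒length≤ {ys = j ∷ []} (Unique.filter⁺ (_≟ j) xs!)
    (λ i∈ → here (proj₂ (∈-filter⁻ (_≟ j) {xs = xs} i∈)))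

  length≤multiplicity*length : ∀ {c xs ys} → (∀ j → multiplicity j xs ≤ c) → xs ⊆ ys →
    length xs ≤ c * length ys
  length≤multiplicity*length {xs = []} _ _ = z≤n
  length≤multiplicity*length {xs = x ∷ xs} {[]} _ x∷xs⊆[] with () ← x∷xs⊆[] (here refl)
  length≤multiplicity*length {c} {xs} {y ∷ ys} mult≤c xs⊆y∷ys = begin
    length xs                           ≡⟨ length-filter-∁ (_≟ y) xs ⟨
    multiplicity y xs + length others   ≤⟨ +-mono-≤ (mult≤c y) others-bound ⟩
    c + c * length ys                   ≡⟨ *-suc c (length ys) ⟨
    c * length (y ∷ ys)                 ∎
    where
    open ≤-Reasoning
    others = filter (¬? ∘ (_≟ y)) xs
    others⊆ys : others ⊆ ys
    others⊆ys z∈others with z∈xs , z≢y ← ∈-filter⁻ (¬? ∘ (_≟ y)) z∈others with xs⊆y∷ys z∈xs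
    ... | here z≡y   = contradiction z≡y z≢y
    ... | there z∈ys = z∈ys
    others-bound : length others ≤ c * length ys
    others-bound = length≤multiplicity*length {xs = others} (λ j → ≤-trans
      (Sublist.length-mono-≤ (Sublist.filter⁺ (_≟ j) (_≟ j) (λ { refl i≡j → i≡j })
                                              (Sublist.filter-⊆ (¬? ∘ (_≟ y)) xs)))
      (mult≤c j)) others⊆ys

  length≤multiplicity*cost : ∀ {c} xs → (∀ j → multiplicity j xs ≤ c) → length xs ≤ c * cost xs
  length≤multiplicity*cost xs mult≤c =
    length≤multiplicity*length {xs = xs} mult≤c (∈-deduplicate⁺ _≟_)

  cost-++ : ∀ xs ys {zs} → (∀ {j} → j ∈ xs → j ∈ ys → j ∈ zs) →
    cost xs + cost ys ≤ cost (xs ++ ys) + length zs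
  cost-++ xs ys {zs} shared∈zs = begin
    length us + length vs                   ≡⟨ cong (length us +_) (length-filter-∁ (_∈? xs) vs) ⟨
    length us + (length vsˣ + length vsᵒ)   ≡⟨ cong (length us +_) (+-comm (length vsˣ) (length vsᵒ)) ⟩
    length us + (length vsᵒ + length vsˣ)   ≡⟨ +-assoc (length us) (length vsᵒ) (length vsˣ) ⟨
    length us + length vsᵒ + length vsˣ     ≡⟨ cong (_+ length vsˣ) (length-++ us) ⟨
    length (us ++ vsᵒ) + length vsˣ         ≤⟨ +-mono-≤ fresh≤cost shared≤zs ⟩
    cost (xs ++ ys) + length zs             ∎
    where
    open ≤-Reasoning
    us = deduplicate _≟_ xs
    vs = deduplicate _≟_ ys
    vsˣ = filter (_∈? xs) vs
    vsᵒ = filter (¬? ∘ (_∈? xs)) vs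
    fresh≤cost : length (us ++ vsᵒ) ≤ cost (xs ++ ys)
    fresh≤cost = Unique-⊆⇒length≤cost {us ++ vsᵒ}
      (Unique.++⁺ (deduplicate-! xs) (Unique.filter⁺ (¬? ∘ (_∈? xs)) (deduplicate-! ys))
        (λ (j∈us , j∈vsᵒ) →
          proj₂ (∈-filter⁻ (¬? ∘ (_∈? xs)) {xs = vs} j∈vsᵒ) (∈-deduplicate⁻ _≟_ xs j∈us)))
      (Subset.++⁺ (∈-deduplicate⁻ _≟_ xs)
                  (∈-deduplicate⁻ _≟_ ys ∘ proj₁ ∘ ∈-filter⁻ (¬? ∘ (_∈? xs)) {xs = vs}))
    shared≤zs : length vsˣ ≤ length zs
    shared≤zs = Unique-⊆⇒length≤ {vsˣ} (Unique.filter⁺ (_∈? xs) (deduplicate-! ys)) λ j∈vsˣ →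
      let j∈vs , j∈xs = ∈-filter⁻ (_∈? xs) {xs = vs} j∈vsˣ
      in shared∈zs j∈xs (∈-deduplicate⁻ _≟_ ys j∈vs)


module Sylvester where

  open import Defs using (π; invπ-1; S)
  open Fractions
  open import Data.Nat using (ℕ; zero; suc; _+_; _*_; _∸_; _≤_; _<_; z≤n; s≤s)
  open import Data.Nat.Properties
  open import Data.Rational as ℚ using (ℚ; 0ℚ)
  import Data.Rational.Properties as ℚ
  open import Data.Sum using (inj₁; inj₂)
  open import Relation.Binary.PropositionalEquality

  -- Written so that `invπ-1 i` is definitionally `+ 1 / π-1 i`.
  π-1 : ℕ → ℕ
  π-1 i = suc (π i ∸ 2)

  π≥2 : ∀ i → 2 ≤ π i
  π≥2 zero    = s≤s (s≤s z≤n)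
  π≥2 (suc i) = m≤n⇒m≤n+o 1 (*-mono-≤ (π≥2 i) (∸-monoˡ-≤ 1 (π≥2 i)))

  π≡1+π-1 : ∀ i → π i ≡ suc (π-1 i)
  π≡1+π-1 i = sym (trans (+-comm 2 (π i ∸ 2)) (m∸n+n≡m (π≥2 i)))

  π-1-suc : ∀ i → π-1 (suc i) ≡ π i * π-1 i
  π-1-suc i = suc-injective (begin
    suc (π-1 (suc i))        ≡⟨ π≡1+π-1 (suc i) ⟨
    π i * (π i ∸ 1) + 1      ≡⟨ +-comm _ 1 ⟩
    suc (π i * (π i ∸ 1))    ≡⟨ cong (λ n → suc (π i * (n ∸ 1))) (π≡1+π-1 i) ⟩
    suc (π i * π-1 i)        ∎)
    where open ≡-Reasoning

  π-mono : ∀ i → π i ≤ π (suc i)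
  π-mono i = m≤n⇒m≤n+o 1 (begin
    π i                ≡⟨ *-identityʳ (π i) ⟨
    π i * 1            ≤⟨ *-monoʳ-≤ (π i) (∸-monoˡ-≤ 1 (π≥2 i)) ⟩
    π i * (π i ∸ 1)    ∎)
    where open ≤-Reasoning

  i<π-1 : ∀ i → i < π-1 i
  i<π-1 zero    = s≤s z≤n
  i<π-1 (suc i) = begin
    2 + i              ≡⟨ +-comm 1 (suc i) ⟩
    suc i + 1          ≤⟨ +-mono-≤ (i<π-1 i) (s≤s z≤n) ⟩
    π-1 i + π-1 i      ≡⟨ cong (π-1 i +_) (+-identityʳ (π-1 i)) ⟨
    2 * π-1 i          ≤⟨ *-monoˡ-≤ (π-1 i) (π≥2 i) ⟩
    π i * π-1 i        ≡⟨ π-1-suc i ⟨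
    π-1 (suc i)        ∎
    where open ≤-Reasoning

  prodπ : ℕ → ℕ → ℕ
  prodπ i zero    = 1
  prodπ i (suc d) = π i * prodπ (suc i) d

  π-1*prodπ : ∀ i d → π-1 i * prodπ i d ≡ π-1 (i + d)
  π-1*prodπ i zero    = trans (*-identityʳ (π-1 i)) (cong π-1 (sym (+-identityʳ i)))
  π-1*prodπ i (suc d) = begin
    π-1 i * (π i * prodπ (suc i) d)   ≡⟨ *-assoc (π-1 i) (π i) _ ⟨
    π-1 i * π i * prodπ (suc i) d     ≡⟨ cong (_* prodπ (suc i) d) (*-comm (π-1 i) (π i)) ⟩
    π i * π-1 i * prodπ (suc i) d     ≡⟨ cong (_* prodπ (suc i) d) (π-1-suc i) ⟨
    π-1 (suc i) * prodπ (suc i) d     ≡⟨ π-1*prodπ (suc i) d ⟩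
    π-1 (suc i + d)                   ≡⟨ cong π-1 (+-suc i d) ⟨
    π-1 (i + suc d)                   ∎
    where open ≡-Reasoning

  invπ-1-nonNeg : ∀ i → 0ℚ ℚ.≤ invπ-1 i
  invπ-1-nonNeg i = frac-mono-≤ 0 0 1 (π i ∸ 2) z≤n

  invπ-1-halves : ∀ i → invπ-1 (suc i) ℚ.+ invπ-1 (suc i) ℚ.≤ invπ-1 i
  invπ-1-halves i = subst (ℚ._≤ invπ-1 i) (sym (frac-+ 1 1 (π (suc i) ∸ 2)))
    (frac-mono-≤ 2 (π (suc i) ∸ 2) 1 (π i ∸ 2) (begin
      2 * π-1 i         ≤⟨ *-monoˡ-≤ (π-1 i) (π≥2 i) ⟩
      π i * π-1 i       ≡⟨ π-1-suc i ⟨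
      π-1 (suc i)       ≡⟨ *-identityˡ _ ⟨
      1 * π-1 (suc i)   ∎))
    where open ≤-Reasoning

  private
    p≤p+q : ∀ p {q} → 0ℚ ℚ.≤ q → p ℚ.≤ p ℚ.+ q
    p≤p+q p 0≤q = subst (ℚ._≤ p ℚ.+ _) (ℚ.+-identityʳ p) (ℚ.+-monoʳ-≤ p 0≤q)

    tail : ℕ → ℚ
    tail n = S n ℚ.+ (invπ-1 n ℚ.+ invπ-1 n)

  S-mono : ∀ k d → S k ℚ.≤ S (k + d)
  S-mono k zero    = ℚ.≤-reflexive (cong S (sym (+-identityʳ k)))
  S-mono k (suc d) = begin
    S k                ≤⟨ S-mono k d ⟩
    S (k + d)          ≤⟨ p≤p+q (S (k + d)) (invπ-1-nonNeg (k + d)) ⟩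
    S (suc (k + d))    ≡⟨ cong S (+-suc k d) ⟨
    S (k + suc d)      ∎
    where open ℚ.≤-Reasoning

  tail-antitone : ∀ k d → tail (k + d) ℚ.≤ tail k
  tail-antitone k zero    = ℚ.≤-reflexive (cong tail (+-identityʳ k))
  tail-antitone k (suc d) = begin
    tail (k + suc d)
      ≡⟨ cong tail (+-suc k d) ⟩
    S (k + d) ℚ.+ invπ-1 (k + d) ℚ.+ (invπ-1 (suc (k + d)) ℚ.+ invπ-1 (suc (k + d)))
      ≤⟨ ℚ.+-monoʳ-≤ (S (k + d) ℚ.+ invπ-1 (k + d)) (invπ-1-halves (k + d)) ⟩
    S (k + d) ℚ.+ invπ-1 (k + d) ℚ.+ invπ-1 (k + d)
      ≡⟨ ℚ.+-assoc (S (k + d)) (invπ-1 (k + d)) (invπ-1 (k + d)) ⟩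
    tail (k + d)
      ≤⟨ tail-antitone k d ⟩
    tail k ∎
    where open ℚ.≤-Reasoning

  S≤S+2invπ-1 : ∀ k N → S N ℚ.≤ S k ℚ.+ (invπ-1 k ℚ.+ invπ-1 k)
  S≤S+2invπ-1 k N with ≤-total N k
  ... | inj₁ N≤k = begin
    S N                ≤⟨ S-mono N (k ∸ N) ⟩
    S (N + (k ∸ N))    ≡⟨ cong S (m+[n∸m]≡n N≤k) ⟩
    S k                ≤⟨ p≤p+q (S k) (ℚ.+-mono-≤ (invπ-1-nonNeg k) (invπ-1-nonNeg k)) ⟩
    tail k             ∎
    where open ℚ.≤-Reasoning
  ... | inj₂ k≤N = begin
    S N                ≤⟨ p≤p+q (S N) (ℚ.+-mono-≤ (invπ-1-nonNeg N) (invπ-1-nonNeg N)) ⟩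
    tail N             ≡⟨ cong tail (m+[n∸m]≡n k≤N) ⟨
    tail (k + (N ∸ k)) ≤⟨ tail-antitone k (N ∸ k) ⟩
    tail k             ∎
    where open ℚ.≤-Reasoning

  Sfrom : ℕ → ℕ → ℚ
  Sfrom i zero    = 0ℚ
  Sfrom i (suc d) = invπ-1 i ℚ.+ Sfrom (suc i) d

  S+Sfrom : ∀ i d → S i ℚ.+ Sfrom i d ≡ S (i + d)
  S+Sfrom i zero    = trans (ℚ.+-identityʳ (S i)) (cong S (sym (+-identityʳ i)))
  S+Sfrom i (suc d) = begin
    S i ℚ.+ (invπ-1 i ℚ.+ Sfrom (suc i) d)   ≡⟨ ℚ.+-assoc (S i) (invπ-1 i) (Sfrom (suc i) d) ⟨
    S (suc i) ℚ.+ Sfrom (suc i) d            ≡⟨ S+Sfrom (suc i) d ⟩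
    S (suc i + d)                            ≡⟨ cong S (+-suc i d) ⟨
    S (i + suc d)                            ∎
    where open ≡-Reasoning

  S≡Sfrom0 : ∀ k → S k ≡ Sfrom 0 k
  S≡Sfrom0 k = trans (sym (S+Sfrom 0 k)) (ℚ.+-identityˡ (Sfrom 0 k))


module Loads where

  open import Defs using (load; sumℚ; cost)
  open Fractions
  open Distinct using (multiplicity; length≤multiplicity*cost)
  open import Data.Nat as ℕ using (ℕ; zero; suc; _+_; _*_; _≤_; _<_; s≤s; s≤s⁻¹; _≟_)
  open import Data.Nat.Properties using
    ( suc-injective; ≤-trans; ≤-reflexive; m≤m+n; m≤n+m; m≤n⇒m⊓n≡m
    ; +-assoc; *-comm; *-zeroʳ; *-suc; *-cancelʳ-<; module ≤-Reasoning)
  open import Data.Integer using (+_)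
  open import Data.Rational as ℚ using (_/_)
  import Data.Rational.Properties as ℚ
  open import Data.List using (List; []; _∷_; _++_; length; map; filter; replicate; take; drop)
  open import Data.List.Properties
    using (length-++; length-replicate; length-take; take++drop≡id; filter-accept; filter-reject)
  open import Data.Product using (_,_; proj₁; proj₂)
  open import Function using (_∘_)
  open import Relation.Nullary using (yes; no)
  open import Relation.Binary.PropositionalEquality

  loadℕ : List ℕ → List ℕ → ℕ → ℕ
  loadℕ []      _       j = 0
  loadℕ (_ ∷ _) []      j = 0
  loadℕ (c ∷ C) (b ∷ g) j with b ≟ j
  ... | yes _ = c + loadℕ C g j
  ... | no  _ = loadℕ C g j

  load-frac : ∀ d C g j → load (map (λ c → + c / suc d) C) g j ≡ + loadℕ C g j / suc d
  load-frac d []      g       j = sym (ℚ.0/n≡0 (suc d))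
  load-frac d (c ∷ C) []      j = sym (ℚ.0/n≡0 (suc d))
  load-frac d (c ∷ C) (b ∷ g) j with b ≟ j
  ... | yes refl = begin
    sumℚ (map proj₁ (filter (λ p → proj₂ p ≟ b) ((+ c / suc d , b) ∷ _)))
      ≡⟨ cong (sumℚ ∘ map proj₁) (filter-accept (λ p → proj₂ p ≟ b) refl) ⟩
    + c / suc d ℚ.+ load (map (λ c → + c / suc d) C) g b
      ≡⟨ cong (+ c / suc d ℚ.+_) (load-frac d C g b) ⟩
    + c / suc d ℚ.+ + loadℕ C g b / suc d
      ≡⟨ frac-+ c (loadℕ C g b) d ⟩
    + (c + loadℕ C g b) / suc d ∎
    where open ≡-Reasoning
  ... | no b≢j = trans (cong (sumℚ ∘ map proj₁) (filter-reject (λ p → proj₂ p ≟ j) b≢j))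
                       (load-frac d C g j)

  loadℕ-++ : ∀ C₁ C₂ {g₁} g₂ j → length g₁ ≡ length C₁ →
    loadℕ (C₁ ++ C₂) (g₁ ++ g₂) j ≡ loadℕ C₁ g₁ j + loadℕ C₂ g₂ j
  loadℕ-++ []       C₂ {[]}     g₂ j _ = refl
  loadℕ-++ (c ∷ C₁) C₂ {b ∷ g₁} g₂ j |g₁|≡|C₁| with b ≟ j
  ... | yes _ = trans (cong (c ℕ.+_) (loadℕ-++ C₁ C₂ g₂ j (suc-injective |g₁|≡|C₁|)))
                      (sym (+-assoc c _ _))
  ... | no  _ = loadℕ-++ C₁ C₂ g₂ j (suc-injective |g₁|≡|C₁|)

  loadℕ-replicate : ∀ n c g j → length g ≤ n → loadℕ (replicate n c) g j ≡ c * multiplicity j g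
  loadℕ-replicate zero    c []      j _ = sym (*-zeroʳ c)
  loadℕ-replicate (suc n) c []      j _ = sym (*-zeroʳ c)
  loadℕ-replicate (suc n) c (b ∷ g) j (s≤s |g|≤n) with b ≟ j
  ... | yes b≡j = begin
    c + loadℕ (replicate n c) g j   ≡⟨ cong (c ℕ.+_) (loadℕ-replicate n c g j |g|≤n) ⟩
    c + c * multiplicity j g        ≡⟨ *-suc c _ ⟨
    c * suc (multiplicity j g)      ≡⟨ cong (λ xs → c * length xs) (filter-accept (_≟ j) b≡j) ⟨
    c * multiplicity j (b ∷ g)      ∎
    where open ≡-Reasoning
  ... | no  b≢j = trans (loadℕ-replicate n c g j |g|≤n)
                        (cong (λ xs → c * length xs) (sym (filter-reject (_≟ j) b≢j)))

  length-replicate-++ : ∀ m (c : ℕ) C → length (replicate m c ++ C) ≡ m + length C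
  length-replicate-++ m c C = trans (length-++ (replicate m c)) (cong (_+ length C) (length-replicate m))

  private
    length-take-≤ : ∀ {A : Set} m (g : List A) → m ≤ length g → length (take m g) ≡ m
    length-take-≤ m g m≤|g| = trans (length-take m g) (m≤n⇒m⊓n≡m m≤|g|)

  loadℕ-replicate-++ : ∀ m c C g j → m ≤ length g →
    loadℕ (replicate m c ++ C) g j ≡ c * multiplicity j (take m g) + loadℕ C (drop m g) j
  loadℕ-replicate-++ m c C g j m≤|g| = begin
    loadℕ (replicate m c ++ C) g j
      ≡⟨ cong (λ h → loadℕ (replicate m c ++ C) h j) (take++drop≡id m g) ⟨
    loadℕ (replicate m c ++ C) (take m g ++ drop m g) j
      ≡⟨ loadℕ-++ (replicate m c) C (drop m g) j (trans |take|≡m (sym (length-replicate m))) ⟩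
    loadℕ (replicate m c) (take m g) j + loadℕ C (drop m g) j
      ≡⟨ cong (_+ loadℕ C (drop m g) j) (loadℕ-replicate m c (take m g) j (≤-reflexive |take|≡m)) ⟩
    c * multiplicity j (take m g) + loadℕ C (drop m g) j ∎
    where
    open ≡-Reasoning
    |take|≡m = length-take-≤ m g m≤|g|

  loadℕ-drop≤ : ∀ m c C g j → m ≤ length g → loadℕ C (drop m g) j ≤ loadℕ (replicate m c ++ C) g j
  loadℕ-drop≤ m c C g j m≤|g| =
    ≤-trans (m≤n+m _ _) (≤-reflexive (sym (loadℕ-replicate-++ m c C g j m≤|g|)))

  head-block-cost : ∀ m c C g {D a} → m ≤ length g →
    (∀ j → loadℕ (replicate m c ++ C) g j ≤ D) → D < suc a * c → m ≤ a * cost (take m g)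
  head-block-cost m c C g {D} {a} m≤|g| load≤D D<[1+a]c = begin
    m                     ≡⟨ length-take-≤ m g m≤|g| ⟨
    length (take m g)     ≤⟨ length≤multiplicity*cost (take m g) multiplicity≤a ⟩
    a * cost (take m g)   ∎
    where
    open ≤-Reasoning
    multiplicity≤a : ∀ j → multiplicity j (take m g) ≤ a
    multiplicity≤a j = s≤s⁻¹ (*-cancelʳ-< c _ (suc a) (begin-strict
      multiplicity j (take m g) * c                          ≡⟨ *-comm _ c ⟩
      c * multiplicity j (take m g)                          ≤⟨ m≤m+n _ _ ⟩
      c * multiplicity j (take m g) + loadℕ C (drop m g) j   ≡⟨ loadℕ-replicate-++ m c C g j m≤|g| ⟨
      loadℕ (replicate m c ++ C) g j                         ≤⟨ load≤D j ⟩
      D                                                      <⟨ D<[1+a]c ⟩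
      suc a * c                                              ∎))


module BoundedSpace where

  open import Defs
  open Distinct using (cost-++)
  open import Data.Nat as ℕ using (ℕ; zero; suc; _+_; _≤_; _<_; z≤n; s≤s; _<?_)
  open import Data.Nat.Properties
    using (≤-trans; <-trans; m≤n⇒m⊓n≡m; +-monoʳ-≤; n≤1+n; module ≤-Reasoning)
  open import Data.Fin using (zero; suc; toℕ; fromℕ<)
  open import Data.Fin.Properties using (toℕ<n; toℕ-fromℕ<)
  open import Data.Rational using (ℚ)
  open import Data.List using (List; []; _∷_; _++_; [_]; length; take; drop; lookup)
  open import Data.List.Properties
    using (length-map; take-map; drop-map; take-take; take-drop; drop-drop; take++drop≡id)
  open import Data.List.Membership.Propositional using (_∈_; _∉_)
  open import Data.List.Membership.Propositional.Properties
    using (∈-map⁻; ∈-concatMap⁻; ∈-concatMap⁺; ∈-filter⁺; ∈-deduplicate⁺)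
  open import Data.List.Membership.DecPropositional ℕ._≟_ using (_∈?_)
  open import Data.List.Relation.Binary.Subset.Propositional using (_⊆_)
  import Data.List.Relation.Binary.Sublist.Propositional as Sublist
  import Data.List.Relation.Binary.Sublist.Propositional.Properties as Sublist
  open import Data.List.Relation.Unary.Any using (here; there)
  open import Data.Product using (∃-syntax; _×_; _,_; proj₁; proj₂)
  open import Relation.Nullary using (¬?; yes; no; contradiction)
  open import Relation.Binary.PropositionalEquality hiding ([_])

  StraddleBounded : ℕ → List ℕ → Set
  StraddleBounded B g =
    ∀ p → ∃[ O ] (length O ≤ B × (∀ {j} → j ∈ take p g → j ∈ drop p g → j ∈ O))

  StraddleBounded-drop : ∀ {B g} q → StraddleBounded B g → StraddleBounded B (drop q g)
  StraddleBounded-drop {g = g} q straddle p with O , |O|≤B , shared∈O ← straddle (q + p) =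
    O , |O|≤B , λ j∈take j∈drop →
      shared∈O (Sublist.Any-resp-⊆ take-drop⊆take j∈take) (subst (_ ∈_) (drop-drop q p g) j∈drop)
    where
    take-drop⊆take : take p (drop q g) Sublist.⊆ take (q + p) g
    take-drop⊆take = subst (Sublist._⊆ take (q + p) g) (sym (take-drop p q g))
                           (Sublist.drop-⊆ q (take (q + p) g))

  cost-take-drop : ∀ {B g} → StraddleBounded B g → ∀ p →
    cost (take p g) + cost (drop p g) ≤ cost g + B
  cost-take-drop {B} {g} straddle p with O , |O|≤B , shared∈O ← straddle p = begin
    cost (take p g) + cost (drop p g)        ≤⟨ cost-++ (take p g) (drop p g) shared∈O ⟩
    cost (take p g ++ drop p g) + length O   ≡⟨ cong (λ h → cost h + length O) (take++drop≡id p g) ⟩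
    cost g + length O                        ≤⟨ +-monoʳ-≤ (cost g) |O|≤B ⟩
    cost g + B                               ∎
    where open ≤-Reasoning

  -- The local recursion of `decisions` cannot be named; `decide` restates it. The `_` in the
  -- types of `decisions-∷` and `go≡decide` stand for that recursion: the first is solved by
  -- `refl`, the second by its use in `after-head` once the accumulator `[] ++ [ a ]` is abstracted.
  decide : Alg → List ℚ → List ℚ → List Decision
  decide alg past []       = []
  decide alg past (a ∷ as) = alg past a ∷ decide alg (past ++ [ a ]) as

  decisions-∷ : ∀ alg a as → decisions alg (a ∷ as) ≡ alg [] a ∷ _
  decisions-∷ alg a as = refl

  decisions≡decide : ∀ alg xs → decisions alg xs ≡ decide alg [] xs
  decisions≡decide alg []       = refl
  decisions≡decide alg (a ∷ as) = after-head as
    where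
    go≡decide : ∀ past xs → _ ≡ decide alg past xs
    go≡decide past []       = refl
    go≡decide past (b ∷ bs) = cong (alg past b ∷_) (go≡decide (past ++ [ b ]) bs)
    after-head : ∀ xs → decisions alg (a ∷ xs) ≡ decide alg [] (a ∷ xs)
    after-head xs rewrite decisions-∷ alg a xs with [] ++ [ a ]
    ... | past = cong (alg [] a ∷_) (go≡decide past xs)

  length-decide : ∀ alg past xs → length (decide alg past xs) ≡ length xs
  length-decide alg past []       = refl
  length-decide alg past (a ∷ as) = cong suc (length-decide alg (past ++ [ a ]) as)

  length-assign : ∀ alg I → length (assign alg I) ≡ length I
  length-assign alg I = trans (length-map bin (decisions alg I))
    (trans (cong length (decisions≡decide alg I)) (length-decide alg [] I))

  ∈-drop⇒lookup : ∀ {A : Set} {x : A} p xs → x ∈ drop p xs → ∃[ t ] (p ≤ toℕ t × x ≡ lookup xs t)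
  ∈-drop⇒lookup zero    (y ∷ xs) (here x≡y)   = zero , z≤n , x≡y
  ∈-drop⇒lookup zero    (y ∷ xs) (there x∈xs)
    with t , _ , x≡xs[t] ← ∈-drop⇒lookup zero xs x∈xs = suc t , z≤n , x≡xs[t]
  ∈-drop⇒lookup (suc p) (y ∷ xs) x∈drop
    with t , p≤t , x≡xs[t] ← ∈-drop⇒lookup p xs x∈drop = suc t , s≤s p≤t , x≡xs[t]

  closedUpTo-mono : ∀ ds {s t} → s ≤ t → closedUpTo ds s ⊆ closedUpTo ds t
  closedUpTo-mono ds {s} {t} s≤t j∈closed = ∈-concatMap⁺ close
    (Sublist.Any-resp-⊆ take⊆take (∈-concatMap⁻ close {xs = take (suc s) ds} j∈closed))
    where
    take⊆take : take (suc s) ds Sublist.⊆ take (suc t) ds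
    take⊆take = subst (Sublist._⊆ take (suc t) ds)
      (trans (take-take (suc s) (suc t) ds) (cong (λ n → take n ds) (m≤n⇒m⊓n≡m (s≤s s≤t))))
      (Sublist.take-⊆ (suc s) (take (suc t) ds))

  -- A bin used after step t is not closed at its later use, hence not closed by step t either:
  -- if it was also used up to step t, it is one of the at most B bins open after step t.
  boundedSpace⇒straddleBounded : ∀ {B alg} → BoundedSpaceAlg B alg →
    ∀ I → ValidItems I → Sorted I → StraddleBounded B (assign alg I)
  boundedSpace⇒straddleBounded {B} {alg} bounded I valid sorted = straddle
    where
    ds = decisions alg I
    invariants = proj₁ (bounded I valid sorted)

    used-later : ∀ {t j} → j ∈ drop (suc t) (assign alg I) →
      ∃[ u ] (t < toℕ u × j ∉ closedUpTo ds t)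
    used-later {t} {j} j∈drop
      with d , d∈drop , j≡bin-d ← ∈-map⁻ bin (subst (j ∈_) (drop-map (suc t) ds) j∈drop)
      with u , t<u , d≡ds[u] ← ∈-drop⇒lookup (suc t) ds d∈drop =
      u , t<u , λ j∈closed → proj₁ (invariants u)
        (subst (_∈ closedUpTo ds (toℕ u)) (trans j≡bin-d (cong bin d≡ds[u]))
               (closedUpTo-mono ds (≤-trans (n≤1+n t) t<u) j∈closed))

    straddle : StraddleBounded B (assign alg I)
    straddle zero = [] , z≤n , λ ()
    straddle (suc t) with t <? length ds
    ... | yes t<|ds| = openAfter ds t , |open|≤B , λ {j} j∈take j∈drop →
      ∈-deduplicate⁺ ℕ._≟_ (∈-filter⁺ (λ i → ¬? (i ∈? closedUpTo ds t))
        (subst (j ∈_) (take-map (suc t) ds) j∈take) (proj₂ (proj₂ (used-later j∈drop))))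
      where
      |open|≤B : length (openAfter ds t) ≤ B
      |open|≤B = subst (λ s → length (openAfter ds s) ≤ B) (toℕ-fromℕ< t<|ds|)
                       (proj₂ (invariants (fromℕ< t<|ds|)))
    ... | no t≮|ds| = [] , z≤n , λ _ j∈drop →
      let u , t<u , _ = used-later j∈drop in contradiction (<-trans t<u (toℕ<n u)) t≮|ds|


module HardInstance where

  open import Defs
  open Fractions
  open Distinct
  open Sylvester
  open Loads
  open BoundedSpace
  open import Data.Nat using (ℕ; zero; suc; _+_; _*_; _∸_; _≤_; _<_; _≥_; z≤n; s≤s)
  open import Data.Nat.Properties
  open import Data.Nat.ListAction using (sum)
  open import Data.Nat.Solver using (module +-*-Solver)
  open import Data.Integer using (+_)
  open import Data.Rational as ℚ using (ℚ; _/_; 0ℚ; 1ℚ)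
  import Data.Rational.Properties as ℚ
  open import Data.List using (List; []; _∷_; _++_; length; map; replicate; concatMap; upTo; take; drop)
  open import Data.List.Properties
    using (length-++; length-map; length-replicate; length-upTo; length-drop)
  open import Data.List.Membership.Propositional.Properties using (∈-concatMap⁻)
  import Data.List.Relation.Binary.Sublist.Propositional.Properties as Sublist
  open import Data.List.Relation.Unary.All as All using (All; []; _∷_)
  import Data.List.Relation.Unary.All.Properties as All
  open import Data.List.Relation.Unary.AllPairs as AllPairs using (AllPairs; []; _∷_)
  import Data.List.Relation.Unary.AllPairs.Properties as AllPairs
  import Data.List.Relation.Unary.Any as Any
  open import Data.List.Relation.Unary.Linked using (Linked; []; [-]; _∷_)
  open import Data.List.Relation.Unary.Linked.Properties using (Linked⇒AllPairs)
  import Data.List.Relation.Unary.Unique.Propositional.Properties as Unique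
  open import Data.Product using (_×_; _,_; proj₂)
  open import Function using (_∘_)
  open import Relation.Binary.PropositionalEquality

  All-≤-sum : ∀ ns → All (_≤ sum ns) ns
  All-≤-sum []       = []
  All-≤-sum (n ∷ ns) = m≤m+n n (sum ns) ∷ All.map (m≤n⇒m≤o+n n) (All-≤-sum ns)

  length-concatMap : ∀ {A B : Set} {f : A → List B} {n} → (∀ x → length (f x) ≡ n) →
    ∀ xs → length (concatMap f xs) ≡ length xs * n
  length-concatMap |f|≡n []       = refl
  length-concatMap {f = f} |f|≡n (x ∷ xs) =
    trans (length-++ (f x)) (cong₂ _+_ (|f|≡n x) (length-concatMap |f|≡n xs))

  cofactor : ℕ → ℕ → ℕ
  cofactor i d = π-1 i * prodπ (suc i) d

  π*cofactor : ∀ i d → π i * cofactor i d ≡ π-1 (i + suc d)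
  π*cofactor i d = begin
    π i * (π-1 i * prodπ (suc i) d)   ≡⟨ *-assoc (π i) (π-1 i) _ ⟨
    π i * π-1 i * prodπ (suc i) d     ≡⟨ cong (_* prodπ (suc i) d) (π-1-suc i) ⟨
    π-1 (suc i) * prodπ (suc i) d     ≡⟨ π-1*prodπ (suc i) d ⟩
    π-1 (suc i + d)                   ≡⟨ cong π-1 (+-suc i d) ⟨
    π-1 (i + suc d)                   ∎
    where open ≡-Reasoning

  -- Numerators, over the denominator K * π-1 (i + d), of the items of levels i, …, i + d - 1:
  -- by `π*cofactor`, an item of level i has size 1 / π i + 1 / (K * π-1 (i + d)).
  levelNumerators : ℕ → ℕ → ℕ → List ℕ
  levelNumerators K i zero    = []
  levelNumerators K i (suc d) = K * cofactor i d + 1 ∷ levelNumerators K (suc i) d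

  levelNumerators-positive : ∀ K i d → All (1 ≤_) (levelNumerators K i d)
  levelNumerators-positive K i zero    = []
  levelNumerators-positive K i (suc d) = m≤n+m 1 _ ∷ levelNumerators-positive K (suc i) d

  cofactor-suc≤ : ∀ i d → cofactor (suc i) d ≤ cofactor i (suc d)
  cofactor-suc≤ i d = begin
    π-1 (suc i) * P           ≡⟨ cong (_* P) (trans (π-1-suc i) (*-comm (π i) (π-1 i))) ⟩
    π-1 i * π i * P           ≡⟨ *-assoc (π-1 i) (π i) P ⟩
    π-1 i * (π i * P)         ≤⟨ *-monoʳ-≤ (π-1 i) (*-monoˡ-≤ P (π-mono i)) ⟩
    π-1 i * (π (suc i) * P)   ∎
    where
    open ≤-Reasoning
    P = prodπ (suc (suc i)) d

  levelNumerators-sorted : ∀ K i d → AllPairs _≥_ (levelNumerators K i d)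
  levelNumerators-sorted K i d = Linked⇒AllPairs (λ b≤a c≤b → ≤-trans c≤b b≤a) (linked i d)
    where
    linked : ∀ i d → Linked _≥_ (levelNumerators K i d)
    linked i zero          = []
    linked i (suc zero)    = [-]
    linked i (suc (suc d)) = +-monoˡ-≤ 1 (*-monoʳ-≤ K (cofactor-suc≤ i d)) ∷ linked (suc i) (suc d)

  sum-levelNumerators : ∀ K i d → sum (levelNumerators K i d) + K ≡ K * prodπ i d + d
  sum-levelNumerators K i zero    = trans (sym (*-identityʳ K)) (sym (+-identityʳ (K * 1)))
  sum-levelNumerators K i (suc d) = begin
    (K * cofactor i d + 1) + sum (levelNumerators K (suc i) d) + K
      ≡⟨ +-assoc (K * cofactor i d + 1) _ K ⟩
    (K * cofactor i d + 1) + (sum (levelNumerators K (suc i) d) + K)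
      ≡⟨ cong (_+_ (K * cofactor i d + 1)) (sum-levelNumerators K (suc i) d) ⟩
    (K * cofactor i d + 1) + (K * P + d)
      ≡⟨ solve 4 (λ K c P d → (K :* c :+ con 1) :+ (K :* P :+ d) := K :* (c :+ P) :+ (con 1 :+ d))
                 refl K (cofactor i d) P d ⟩
    K * (cofactor i d + P) + suc d
      ≡⟨ cong (λ n → K * n + suc d) cofactor+P≡π*P ⟩
    K * prodπ i (suc d) + suc d ∎
    where
    open ≡-Reasoning
    open +-*-Solver
    P = prodπ (suc i) d
    cofactor+P≡π*P : cofactor i d + P ≡ π i * P
    cofactor+P≡π*P = begin
      π-1 i * P + P       ≡⟨ cong (_+_ (π-1 i * P)) (*-identityˡ P) ⟨
      π-1 i * P + 1 * P   ≡⟨ *-distribʳ-+ P (π-1 i) 1 ⟨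
      (π-1 i + 1) * P     ≡⟨ cong (_* P) (trans (+-comm (π-1 i) 1) (sym (π≡1+π-1 i))) ⟩
      π i * P             ∎

  level-item-large : ∀ K i d → K * π-1 (i + suc d) < π i * (K * cofactor i d + 1)
  level-item-large K i d = begin-strict
    K * π-1 (i + suc d)              <⟨ m<m+n _ (≤-trans (s≤s z≤n) (π≥2 i)) ⟩
    K * π-1 (i + suc d) + π i        ≡⟨ cong (λ n → K * n + π i) (π*cofactor i d) ⟨
    K * (π i * cofactor i d) + π i   ≡⟨ solve 3 (λ K p c → K :* (p :* c) :+ p := p :* (K :* c :+ con 1))
                                                refl K (π i) (cofactor i d) ⟩
    π i * (K * cofactor i d + 1)     ∎
    where
    open ≤-Reasoning
    open +-*-Solver

  blocks : ℕ → List ℕ → List ℕ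
  blocks m = concatMap (replicate m)

  blocks-All : ∀ {P : ℕ → Set} m {cs} → All P cs → All P (blocks m cs)
  blocks-All m = All.concat⁺ ∘ All.map⁺ ∘ All.map (All.replicate⁺ m)

  blocks-sorted : ∀ m {cs} → AllPairs _≥_ cs → AllPairs _≥_ (blocks m cs)
  blocks-sorted m {cs} cs-sorted = AllPairs.concat⁺
    (All.map⁺ (All.universal (replicate-sorted m) cs))
    (AllPairs.map⁺ (AllPairs.map (All.replicate⁺ m ∘ All.replicate⁺ m) cs-sorted))
    where
    replicate-sorted : ∀ n (c : ℕ) → AllPairs _≥_ (replicate n c)
    replicate-sorted zero    c = []
    replicate-sorted (suc n) c = All.replicate⁺ n ≤-refl ∷ replicate-sorted n c

  module Instance (m k′ : ℕ) where

    k : ℕ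
    k = suc k′

    D : ℕ
    D = k * π-1 k

    numerators : List ℕ
    numerators = levelNumerators k 0 k

    C : List ℕ
    C = blocks m numerators

    I : List ℚ
    I = map (λ c → + c / D) C

    sum-numerators : sum numerators ≡ D
    sum-numerators = +-cancelʳ-≡ k (sum numerators) D (begin
      sum numerators + k   ≡⟨ sum-levelNumerators k 0 k ⟩
      k * prodπ 0 k + k    ≡⟨ cong (λ n → k * n + k) prodπ0≡π-1 ⟩
      D + k                ∎)
      where
      open ≡-Reasoning
      prodπ0≡π-1 : prodπ 0 k ≡ π-1 k
      prodπ0≡π-1 = trans (sym (*-identityˡ (prodπ 0 k))) (π-1*prodπ 0 k)

    valid : ValidItems I
    valid = All.map⁺ (blocks-All m (All.zipWith item-valid (levelNumerators-positive k 0 k , numerator≤D)))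
      where
      numerator≤D : All (_≤ D) numerators
      numerator≤D = subst (λ s → All (_≤ s) numerators) sum-numerators (All-≤-sum numerators)
      item-valid : ∀ {c} → 1 ≤ c × c ≤ D → 0ℚ ℚ.< + c / D × + c / D ℚ.≤ 1ℚ
      item-valid {c} (1≤c , c≤D) =
        frac-mono-< 0 0 c _ (subst (0 <_) (sym (*-identityʳ c)) 1≤c) ,
        frac-mono-≤ c _ 1 0 (subst₂ _≤_ (sym (*-identityʳ c)) (sym (*-identityˡ D)) c≤D)

    sorted : Sorted I
    sorted = AllPairs.map⁺ (AllPairs.map (λ {a} {b} b≤a → frac-mono-≤ b _ a _ (*-monoˡ-≤ D b≤a))
                                         (blocks-sorted m (levelNumerators-sorted k 0 k)))

    load≤1⇒loadℕ≤D : ∀ g j → load I g j ℚ.≤ 1ℚ → loadℕ C g j ≤ D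
    load≤1⇒loadℕ≤D g j load≤1 = subst₂ _≤_ (*-identityʳ _) (*-identityˡ D)
      (frac-cancel-≤ (loadℕ C g j) _ 1 0 (subst (ℚ._≤ 1ℚ) (load-frac _ C g j) load≤1))

    loadℕ≤D⇒load≤1 : ∀ g j → loadℕ C g j ≤ D → load I g j ℚ.≤ 1ℚ
    loadℕ≤D⇒load≤1 g j loadℕ≤D = subst (ℚ._≤ 1ℚ) (sym (load-frac _ C g j))
      (frac-mono-≤ (loadℕ C g j) _ 1 0 (subst₂ _≤_ (sym (*-identityʳ _)) (sym (*-identityˡ D)) loadℕ≤D))

    levelwise : List ℕ → List ℕ
    levelwise = concatMap (λ _ → upTo m)

    loadℕ-levelwise : ∀ cs j → loadℕ (blocks m cs) (levelwise cs) j ≤ sum cs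
    loadℕ-levelwise []       j = z≤n
    loadℕ-levelwise (c ∷ cs) j = begin
      loadℕ (replicate m c ++ blocks m cs) (upTo m ++ levelwise cs) j
        ≡⟨ loadℕ-++ (replicate m c) _ (levelwise cs) j (trans (length-upTo m) (sym (length-replicate m))) ⟩
      loadℕ (replicate m c) (upTo m) j + loadℕ (blocks m cs) (levelwise cs) j
        ≤⟨ +-mono-≤ head-block (loadℕ-levelwise cs j) ⟩
      c + sum cs ∎
      where
      open ≤-Reasoning
      head-block : loadℕ (replicate m c) (upTo m) j ≤ c
      head-block = begin
        loadℕ (replicate m c) (upTo m) j   ≡⟨ loadℕ-replicate m c (upTo m) j (≤-reflexive (length-upTo m)) ⟩
        c * multiplicity j (upTo m)        ≤⟨ *-monoʳ-≤ c (Unique⇒multiplicity≤1 j (Unique.upTo⁺ m)) ⟩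
        c * 1                              ≡⟨ *-identityʳ c ⟩
        c                                  ∎

    levelwise-assignment : IsAssignment I (levelwise numerators)
    levelwise-assignment = |levelwise|≡|I| , λ j → loadℕ≤D⇒load≤1 _ j
      (≤-trans (loadℕ-levelwise numerators j) (≤-reflexive sum-numerators))
      where
      |levelwise|≡|I| : length (levelwise numerators) ≡ length I
      |levelwise|≡|I| = begin
        length (levelwise numerators)
          ≡⟨ length-concatMap {f = λ _ → upTo m} (λ _ → length-upTo m) numerators ⟩
        length numerators * m
          ≡⟨ length-concatMap {f = replicate m} (λ _ → length-replicate m) numerators ⟨
        length C
          ≡⟨ length-map _ C ⟨
        length I ∎
        where open ≡-Reasoning

    cost-levelwise : cost (levelwise numerators) ≤ m
    cost-levelwise = subst (cost (levelwise numerators) ≤_) (length-upTo m) (⊆⇒cost≤length λ j∈ →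
      proj₂ (Any.satisfied (∈-concatMap⁻ (λ _ → upTo m) {xs = numerators} j∈)))

    -- The m largest items exceed 1/2 each, so they need m distinct bins.
    m≤opt : ∀ g → IsAssignment I g → m ≤ cost g
    m≤opt g (|g|≡|I| , load≤1) = ≤-trans
      (subst (m ≤_) (*-identityˡ (cost (take m g)))
        (head-block-cost m _ (blocks m (levelNumerators k 1 k′)) g {a = 1} m≤|g|
          (λ j → load≤1⇒loadℕ≤D g j (load≤1 j)) (level-item-large k 0 k′)))
      (cost-mono (Sublist.Any-resp-⊆ (Sublist.take-⊆ m g)))
      where
      m≤|g| : m ≤ length g
      m≤|g| = subst (m ≤_) (sym (trans |g|≡|I| (trans (length-map _ C) (length-replicate-++ m _ _))))
                    (m≤m+n m _)

    isOPT : IsOPT I m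
    isOPT = (levelwise numerators , levelwise-assignment ,
             ≤-antisym cost-levelwise (m≤opt _ levelwise-assignment))
          , m≤opt

    levels-lower-bound : ∀ {B} i d g → i + d ≡ k → StraddleBounded B g →
      length g ≡ length (blocks m (levelNumerators k i d)) →
      (∀ j → loadℕ (blocks m (levelNumerators k i d)) g j ≤ D) →
      fromℕ m ℚ.* Sfrom i d ℚ.≤ fromℕ (cost g + d * B)
    levels-lower-bound i zero g _ _ _ _ =
      subst (ℚ._≤ fromℕ (cost g + 0)) (sym (ℚ.*-zeroʳ (fromℕ m))) (fromℕ-mono-≤ {0} {cost g + 0} z≤n)
    levels-lower-bound {B} i (suc d) g i+d≡k straddle |g|≡|C| load≤D = begin
      fromℕ m ℚ.* (invπ-1 i ℚ.+ Sfrom (suc i) d)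
        ≡⟨ ℚ.*-distribˡ-+ (fromℕ m) (invπ-1 i) (Sfrom (suc i) d) ⟩
      fromℕ m ℚ.* invπ-1 i ℚ.+ fromℕ m ℚ.* Sfrom (suc i) d
        ≤⟨ ℚ.+-mono-≤ this-level later-levels ⟩
      fromℕ (cost (take m g)) ℚ.+ fromℕ (cost (drop m g) + d * B)
        ≡⟨ fromℕ-+ (cost (take m g)) _ ⟨
      fromℕ (cost (take m g) + (cost (drop m g) + d * B))
        ≤⟨ fromℕ-mono-≤ shared-bins ⟩
      fromℕ (cost g + suc d * B) ∎
      where
      open ℚ.≤-Reasoning
      cᵢ = k * cofactor i d + 1
      later = blocks m (levelNumerators k (suc i) d)
      |g|≡m+|later| : length g ≡ m + length later
      |g|≡m+|later| = trans |g|≡|C| (length-replicate-++ m cᵢ later)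
      m≤|g| : m ≤ length g
      m≤|g| = subst (m ≤_) (sym |g|≡m+|later|) (m≤m+n m (length later))
      D<π*cᵢ : D < suc (π-1 i) * cᵢ
      D<π*cᵢ = subst₂ (λ n p → k * π-1 n < p * cᵢ) i+d≡k (π≡1+π-1 i) (level-item-large k i d)
      this-level : fromℕ m ℚ.* invπ-1 i ℚ.≤ fromℕ (cost (take m g))
      this-level = m≤n*x⇒m*1/n≤x m (π i ∸ 2) _
        (head-block-cost m cᵢ later g {a = π-1 i} m≤|g| load≤D D<π*cᵢ)
      later-levels : fromℕ m ℚ.* Sfrom (suc i) d ℚ.≤ fromℕ (cost (drop m g) + d * B)
      later-levels = levels-lower-bound (suc i) d (drop m g) (trans (sym (+-suc i d)) i+d≡k)
        (StraddleBounded-drop m straddle)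
        (trans (length-drop m g) (trans (cong (_∸ m) |g|≡m+|later|) (m+n∸m≡n m (length later))))
        (λ j → ≤-trans (loadℕ-drop≤ m cᵢ later g j m≤|g|) (load≤D j))
      shared-bins : cost (take m g) + (cost (drop m g) + d * B) ≤ cost g + suc d * B
      shared-bins = subst₂ _≤_ (+-assoc (cost (take m g)) _ _) (+-assoc (cost g) B (d * B))
                               (+-monoˡ-≤ (d * B) (cost-take-drop straddle m))

    alg-lower-bound : ∀ {B alg} → BoundedSpaceAlg B alg →
      fromℕ m ℚ.* S k ℚ.≤ fromℕ (ALG alg I) ℚ.+ fromℕ (B * k)
    alg-lower-bound {B} {alg} bounded = subst₂ ℚ._≤_
      (cong (fromℕ m ℚ.*_) (sym (S≡Sfrom0 k)))
      (trans (cong (λ n → fromℕ (ALG alg I + n)) (*-comm k B)) (fromℕ-+ (ALG alg I) (B * k)))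
      (levels-lower-bound 0 k (assign alg I) refl (boundedSpace⇒straddleBounded bounded I valid sorted)
        (trans (length-assign alg I) (length-map _ C))
        (λ j → load≤1⇒loadℕ≤D (assign alg I) j (proj₂ (bounded I valid sorted) j)))


module Limit where

  open import Defs
  open Fractions
  open Sylvester
  open import Data.Nat as ℕ using (ℕ; suc; zero; z≤n; _∸_)
  import Data.Nat.Properties as ℕ
  open import Data.Integer as ℤ using (+_; +[1+_]; -[1+_])
  open import Data.Rational using (ℚ; mkℚ; 0ℚ; 1ℚ; _+_; _-_; _*_; -_; _≤_; _<_; *<*; nonNegative)
  import Data.Rational.Properties as ℚ
  open import Data.Rational.Solver using (module +-*-Solver)
  open import Data.Product using (∃-syntax; _,_)
  open import Relation.Binary.PropositionalEquality

  private
    0≤q-p : ∀ {p q} → p ≤ q → 0ℚ ≤ q - p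
    0≤q-p {p} {q} p≤q = subst (_≤ q - p) (ℚ.+-inverseʳ p) (ℚ.+-monoˡ-≤ (- p) p≤q)

    p-q≤p : ∀ p {q} → 0ℚ ≤ q → p - q ≤ p
    p-q≤p p {q} 0≤q = subst (p - q ≤_) (ℚ.+-identityʳ p) (ℚ.+-monoʳ-≤ p (ℚ.neg-antimono-≤ 0≤q))

  LimLt-from-tail : ∀ {f : ℕ → ℚ} {t τ δ M A F} → τ < δ → 1ℚ ≤ M →
    (∀ N → f N ≤ t + τ) → M * t ≤ A + F → LimLt (λ N → (f N - δ) * M - F) A
  LimLt-from-tail {f} {t} {τ} {δ} {M} {A} {F} τ<δ 1≤M f≤t+τ Mt≤A+F =
    ε , subst (_< ε) (ℚ.+-inverseʳ τ) (ℚ.+-monoˡ-< (- τ) τ<δ) , λ N → begin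
      (f N - δ) * M - F + ε   ≡⟨ solve 4 (λ x M F ε → x :* M :- F :+ ε := x :* M :+ ε :- F)
                                         refl (f N - δ) M F ε ⟩
      (f N - δ) * M + ε - F   ≤⟨ ℚ.+-monoˡ-≤ (- F) (slack N) ⟩
      M * t - F               ≤⟨ ℚ.+-monoˡ-≤ (- F) Mt≤A+F ⟩
      A + F - F               ≡⟨ solve 2 (λ A F → A :+ F :- F := A) refl A F ⟩
      A                       ∎
    where
    open ℚ.≤-Reasoning
    open +-*-Solver
    ε = δ - τ
    slack : ∀ N → (f N - δ) * M + ε ≤ M * t
    slack N = begin
      (f N - δ) * M + ε
        ≤⟨ ℚ.+-monoˡ-≤ ε (ℚ.*-monoʳ-≤-nonNeg M {{M≥0}} (ℚ.+-monoˡ-≤ (- δ) (f≤t+τ N))) ⟩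
      (t + τ - δ) * M + ε
        ≡⟨ solve 4 (λ t τ δ M → (t :+ τ :- δ) :* M :+ (δ :- τ) := M :* t :- (δ :- τ) :* (M :- con 1ℚ))
                   refl t τ δ M ⟩
      M * t - ε * (M - 1ℚ)
        ≤⟨ p-q≤p (M * t) (subst (_≤ ε * (M - 1ℚ)) (ℚ.*-zeroʳ ε)
                                (ℚ.*-monoˡ-≤-nonNeg ε {{ε≥0}} (0≤q-p 1≤M))) ⟩
      M * t ∎
      where
      M≥0 = nonNegative (ℚ.≤-trans (frac-mono-≤ 0 0 1 0 z≤n) 1≤M)
      ε≥0 = nonNegative (0≤q-p (ℚ.<⇒≤ τ<δ))

  -- For δ = (n + 1) / (d + 1), k = 2 (d + 1) levels suffice since k < π-1 k.
  enough-levels : ∀ δ → 0ℚ < δ → ∃[ k′ ] (invπ-1 (suc k′) + invπ-1 (suc k′) < δ)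
  enough-levels (mkℚ (+ zero) d _) (*<* (ℤ.+<+ ()))
  enough-levels (mkℚ -[1+ n ] d _) (*<* ())
  enough-levels δ@(mkℚ +[1+ n ] d _) _ = k′ ,
    subst₂ _<_ (sym (frac-+ 1 1 (π k ∸ 2))) (ℚ.↥p/↧p≡p δ) (frac-mono-< 2 (π k ∸ 2) (suc n) d 2d<nπ-1)
    where
    k′ = d ℕ.+ suc d
    k = suc k′
    2d<nπ-1 : 2 ℕ.* suc d ℕ.< suc n ℕ.* π-1 k
    2d<nπ-1 = begin-strict
      2 ℕ.* suc d       ≡⟨ cong (λ x → suc (d ℕ.+ suc x)) (ℕ.+-identityʳ d) ⟩
      k                 <⟨ i<π-1 k ⟩
      π-1 k             ≤⟨ ℕ.m≤m+n (π-1 k) (n ℕ.* π-1 k) ⟩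
      suc n ℕ.* π-1 k   ∎
      where open ℕ.≤-Reasoning


open import Defs
open import Data.Nat using (ℕ; _≤_; _∸_) renaming (_*_ to _*ℕ_)
open import Data.Rational using (ℚ; 0ℚ; _<_; _-_; _*_; _+_)
open import Data.List using (List)
open import Data.Product using (Σ; ∃; ∃-syntax; _×_)
open import Data.Nat using (suc; z≤n; s≤s)
open import Data.Product using (_,_)
open Fractions using (fromℕ-mono-≤)
open Sylvester using (S≤S+2invπ-1)
open HardInstance using (module Instance)
open Limit using (LimLt-from-tail; enough-levels)

theorem6 : ∀ (δ : ℚ) → 0ℚ < δ → LtLim δ S →
    ∃[ K ] ((1 ≤ K) ×
      (∀ (B : ℕ) (alg : Alg) → BoundedSpaceAlg B alg →
        ∀ (m : ℕ) → 1 ≤ m →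
          ∃[ I ] (ValidItems I × Sorted I × IsOPT I m ×
            LimLt (λ N → (S N - δ) * fromℕ m - fromℕ (B *ℕ (K ∸ 1)))
                  (fromℕ (ALG alg I)))))
theorem6 δ 0<δ _ with k′ , τ<δ ← enough-levels δ 0<δ =
  suc (suc k′) , s≤s z≤n , λ B alg bounded m 1≤m → let open Instance m k′ in
    I , valid , sorted , isOPT ,
    LimLt-from-tail τ<δ (fromℕ-mono-≤ 1≤m) (S≤S+2invπ-1 k) (alg-lower-bound bounded)
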